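{- Let $\mathbf H$ be either $\mathbf Z$ or $\mathbf N$. The family of small subsets of $\mathbf H$ is an ideal on $\mathbf H$ (i.e., a family of proper subsets of $\mathbf H$ closed under taking subsets and finite unions). In particular, every subset of a small set is small.
   Context: $\mathbf N=\{0,1,2,\dots\}$, $\mathbf N^+=\mathbf N\setminus\{0\}$. For $X\subseteq\mathbf H$, $k\in\mathbf N^+$, $h\in\mathbf N$ write $k\cdot X+h:=\{kx+h:x\in X\}$. An upper quasi-density on $\mathbf H$ is a function $\mu^\ast:\mathcal P(\mathbf H)\to\mathbf R$ such that for all $X,Y\subseteq\mathbf H$, $k\in\mathbf N^+$, $h\in\mathbf N$: $\mu^\ast(X)\le 1$, $\mu^\ast(\mathbf H)=1$, $\mu^\ast(X\cup Y)\le\mu^\ast(X)+\mu^\ast(Y)$, $\mu^\ast(k\cdot X)=\frac1k\mu^\ast(X)$, and $\mu^\ast(X+h)=\mu^\ast(X)$. A set $X\subseteq\mathbf H$ is small if $\mu^\ast(X)=0$ for every upper quasi-density $\mu^\ast$ on $\mathbf H$. -}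

module Defs where

open import Level using (0ℓ)
open import Data.Nat as ℕ using (ℕ; suc; NonZero)
open import Data.Integer as ℤ using (ℤ; +_)
open import Data.Product using (Σ; ∃; _×_; _,_)
open import Data.Empty using (⊥)
open import Data.Sum using (_⊎_)
open import Relation.Nullary using (¬_)
open import Relation.Unary using (Pred; _⊆_; _≐_; _∪_; ∅; U)
open import Relation.Binary.PropositionalEquality using (_≡_)
open import Algebra.Bundles using (CommutativeRing)

-- The real numbers, axiomatised as a Dedekind-complete ordered field
-- (unique up to isomorphism).  The theorem is stated for an arbitrary
-- such model ℝ.

record RealField : Set₁ where
  field
    commRing : CommutativeRing 0ℓ 0ℓ
  open CommutativeRing commRing public
  infix 4 _≤_
  field
    _≤_        : Carrier → Carrier → Set
    ≤-respˡ-≈  : ∀ {x y z} → x ≈ y → x ≤ z → y ≤ z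
    ≤-respʳ-≈  : ∀ {x y z} → y ≈ z → x ≤ y → x ≤ z
    ≤-refl     : ∀ {x} → x ≤ x
    ≤-trans    : ∀ {x y z} → x ≤ y → y ≤ z → x ≤ z
    ≤-antisym  : ∀ {x y} → x ≤ y → y ≤ x → x ≈ y
    ≤-total    : ∀ x y → (x ≤ y) ⊎ (y ≤ x)
    +-mono-≤   : ∀ {x y} z → x ≤ y → x + z ≤ y + z
    *-nonneg   : ∀ {x y} → 0# ≤ x → 0# ≤ y → 0# ≤ x * y
    1≉0        : ¬ (1# ≈ 0#)
    inverse    : ∀ x → ¬ (x ≈ 0#) → Σ Carrier (λ y → x * y ≈ 1#)
    sup        : (S : Pred Carrier 0ℓ) → Σ Carrier S →
                 Σ Carrier (λ b → ∀ s → S s → s ≤ b) →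
                 Σ Carrier (λ m → (∀ s → S s → s ≤ m) ×
                                   (∀ b → (∀ s → S s → s ≤ b) → m ≤ b))

  fromℕ : ℕ → Carrier
  fromℕ ℕ.zero    = 0#
  fromℕ (suc n) = 1# + fromℕ n

data Host : Set where
  Hℕ Hℤ : Host

⟦_⟧ : Host → Set
⟦ Hℕ ⟧ = ℕ
⟦ Hℤ ⟧ = ℤ

lin : (H : Host) → ℕ → ⟦ H ⟧ → ℕ → ⟦ H ⟧
lin Hℕ k x h = k ℕ.* x ℕ.+ h
lin Hℤ k x h = (+ k) ℤ.* x ℤ.+ (+ h)

_·_+_ : {H : Host} → ℕ → Pred ⟦ H ⟧ 0ℓ → ℕ → Pred ⟦ H ⟧ 0ℓ
_·_+_ {H} k X h y = ∃ λ x → X x × (y ≡ lin H k x h)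

_·_ : {H : Host} → ℕ → Pred ⟦ H ⟧ 0ℓ → Pred ⟦ H ⟧ 0ℓ
k · X = k · X + 0

_+ₛ_ : {H : Host} → Pred ⟦ H ⟧ 0ℓ → ℕ → Pred ⟦ H ⟧ 0ℓ
X +ₛ h = 1 · X + h

record IsUpperQuasiDensity (ℝ : RealField) (H : Host)
         (μ : Pred ⟦ H ⟧ 0ℓ → RealField.Carrier ℝ) : Set₁ where
  open RealField ℝ
  field
    -- μ* is a function on the power set: it depends only on the elements
    cong    : ∀ {X Y} → X ≐ Y → μ X ≈ μ Y
    ≤1      : ∀ X → μ X ≤ 1#
    full    : μ U ≈ 1#
    subadd  : ∀ X Y → μ (X ∪ Y) ≤ μ X + μ Y
    -- μ*(k·X) = μ*(X)/k, written as k · μ*(k·X) = μ*(X)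
    scale   : ∀ X k → .{{NonZero k}} → fromℕ k * μ (k · X) ≈ μ X
    shift   : ∀ X h → μ (X +ₛ h) ≈ μ X

Small : (ℝ : RealField) (H : Host) → Pred (Pred ⟦ H ⟧ 0ℓ) (Level.suc 0ℓ)
Small ℝ H X = (μ : Pred ⟦ H ⟧ 0ℓ → RealField.Carrier ℝ) →
              IsUpperQuasiDensity ℝ H μ → RealField._≈_ ℝ (μ X) (RealField.0# ℝ)

record IsIdeal {H : Host} {ℓ} (I : Pred (Pred ⟦ H ⟧ 0ℓ) ℓ) : Set (Level.suc 0ℓ Level.⊔ ℓ) where
  field
    proper    : ∀ {X} → I X → ¬ (U ⊆ X)
    empty     : I ∅
    downward  : ∀ {X Y} → X ⊆ Y → I Y → I X
    union     : ∀ {X Y} → I X → I Y → I (X ∪ Y)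

{-# OPTIONS --safe #-}
-- The upper Buck density 𝔟*(X) = inf { |L| / m : X ⊆ ⋃_{l ∈ L} (m𝐇 + l) } is itself an upper
-- quasi-density, and it dominates every upper quasi-density μ*: for 0 ≤ l < m we have
-- X ∩ (m𝐇 + l) = m·Xₗ + l with Xₗ = {y : my + l ∈ X}, so shift and scale invariance give
-- μ*(X ∩ (m𝐇 + l)) = μ*(Xₗ)/m ≤ 1/m, and subadditivity bounds μ*(X) by |L|/m for every cover.
-- Hence X is small exactly when 𝔟*(X) = 0; as 𝔟* is monotone, subsets of small sets are small,
-- and 𝔟*(𝐇) = 1 shows that 𝐇 is not small. Finite unions need only subadditivity and μ* ≥ 0,
-- and μ*(∅) = 0 because μ*(∅) = μ*(2·∅) = μ*(∅)/2.
module Submission where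

open import Defs
open import Level using (0ℓ)
open import Data.Nat as ℕ using (ℕ; zero; suc; NonZero; _<_)
import Data.Nat.Properties as ℕ
open import Data.Nat.DivMod using (_/_; _%_; m%n<n; m≡m%n+[m/n]*n; m*n/n≡m; [m+kn]%n≡m%n; m<n⇒m%n≡m)
open import Data.Integer using (+_)
import Data.Integer.Properties as ℤ
open import Data.Integer.DivMod using (_%ℕ_; _/ℕ_; n%ℕd<d; a≡a%ℕn+[a/ℕn]*n)
open import Data.Integer.Tactic.RingSolver using (solve-∀)
open import Data.Fin using (Fin; toℕ)
import Data.Fin.Properties as Fin
open import Data.List using (List; []; _∷_; map; length; _++_; applyUpTo; concatMap; lookup)
open import Data.List.Properties using (length-map; length-++; length-applyUpTo)
open import Data.List.Relation.Unary.All as All using (All; []; _∷_)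
import Data.List.Relation.Unary.All.Properties as All
open import Data.List.Relation.Unary.Any as Any using (Any; here; there; index)
open import Data.List.Relation.Unary.Any.Properties
  using (++⁺ˡ; ++⁺ʳ; map⁺; concatMap⁺; applyUpTo⁺; lookup-index)
open import Data.Product using (Σ; ∃; _×_; _,_; proj₁; proj₂)
open import Data.Sum using (inj₁; inj₂)
open import Data.Unit using (tt)
open import Data.Empty using (⊥-elim)
open import Function using (_∘_)
open import Relation.Nullary using (¬_)
open import Relation.Unary using (Pred; _⊆_; _≐_; _∪_; _∩_; ∅; U)
import Relation.Binary.PropositionalEquality as ≡
open import Relation.Binary.Structures using (IsPreorder)
open import Relation.Binary.Bundles using (Poset)
import Relation.Binary.Reasoning.PartialOrder as PartialOrderReasoning
import Algebra.Properties.Ring as RingProperties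
import Algebra.Properties.Group as GroupProperties
import Algebra.Properties.CommutativeSemigroup as CommutativeSemigroupProperties

module OrderedFieldProperties (ℝ : RealField) where
  open RealField ℝ
  open RingProperties ring using (-1*x≈-x; -‿distribʳ-*)
  open GroupProperties +-group using (⁻¹-involutive)

  ≤-isPreorder : IsPreorder _≈_ _≤_
  ≤-isPreorder = record
    { isEquivalence = isEquivalence
    ; reflexive     = λ x≈y → ≤-respʳ-≈ x≈y ≤-refl
    ; trans         = ≤-trans
    }

  ≤-poset : Poset 0ℓ 0ℓ 0ℓ
  ≤-poset = record { isPartialOrder = record { isPreorder = ≤-isPreorder ; antisym = ≤-antisym } }

  module ≤-Reasoning = PartialOrderReasoning ≤-poset

  ≤-reflexive : ∀ {x y} → x ≈ y → x ≤ y
  ≤-reflexive = IsPreorder.reflexive ≤-isPreorder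

  ≤-resp-≈ : ∀ {x y x′ y′} → x ≈ x′ → y ≈ y′ → x ≤ y → x′ ≤ y′
  ≤-resp-≈ x≈x′ y≈y′ x≤y = ≤-respʳ-≈ y≈y′ (≤-respˡ-≈ x≈x′ x≤y)

  +-monoʳ-≤ : ∀ z {x y} → x ≤ y → z + x ≤ z + y
  +-monoʳ-≤ z x≤y = ≤-resp-≈ (+-comm _ z) (+-comm _ z) (+-mono-≤ z x≤y)

  +-mono₂-≤ : ∀ {x y u v} → x ≤ y → u ≤ v → x + u ≤ y + v
  +-mono₂-≤ {y = y} {u} x≤y u≤v = ≤-trans (+-mono-≤ u x≤y) (+-monoʳ-≤ y u≤v)

  x+y-y≈x : ∀ x y → x + y - y ≈ x
  x+y-y≈x x y = trans (+-assoc x y (- y)) (trans (+-congˡ (-‿inverseʳ y)) (+-identityʳ x))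

  x-y+y≈x : ∀ x y → x - y + y ≈ x
  x-y+y≈x x y = trans (+-assoc x (- y) y) (trans (+-congˡ (-‿inverseˡ y)) (+-identityʳ x))

  x≤y+z⇒x-z≤y : ∀ {x y z} → x ≤ y + z → x - z ≤ y
  x≤y+z⇒x-z≤y {y = y} {z} x≤y+z = ≤-respʳ-≈ (x+y-y≈x y z) (+-mono-≤ (- z) x≤y+z)

  x-z≤y⇒x≤y+z : ∀ {x y z} → x - z ≤ y → x ≤ y + z
  x-z≤y⇒x≤y+z {x} {z = z} x-z≤y = ≤-respˡ-≈ (x-y+y≈x x z) (+-mono-≤ z x-z≤y)

  x≤y⇒0≤y-x : ∀ {x y} → x ≤ y → 0# ≤ y - x
  x≤y⇒0≤y-x {x} x≤y = ≤-respˡ-≈ (-‿inverseʳ x) (+-mono-≤ (- x) x≤y)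

  0≤y-x⇒x≤y : ∀ {x y} → 0# ≤ y - x → x ≤ y
  0≤y-x⇒x≤y {x} {y} 0≤y-x = ≤-resp-≈ (+-identityˡ x) (x-y+y≈x y x) (+-mono-≤ x 0≤y-x)

  *-monoˡ-≤-nonneg : ∀ {z x y} → 0# ≤ z → x ≤ y → z * x ≤ z * y
  *-monoˡ-≤-nonneg {z} {x} {y} 0≤z x≤y =
    0≤y-x⇒x≤y (≤-respʳ-≈ z*[y-x]≈zy-zx (*-nonneg 0≤z (x≤y⇒0≤y-x x≤y)))
    where
    z*[y-x]≈zy-zx : z * (y - x) ≈ z * y - z * x
    z*[y-x]≈zy-zx = trans (distribˡ z y (- x)) (+-congˡ (sym (-‿distribʳ-* z x)))

  0≤1 : 0# ≤ 1#
  0≤1 with ≤-total 0# 1#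
  ... | inj₁ 0≤1 = 0≤1
  ... | inj₂ 1≤0 = ≤-respʳ-≈ -1*-1≈1 (*-nonneg 0≤-1 0≤-1)
    where
    0≤-1 : 0# ≤ - 1#
    0≤-1 = ≤-resp-≈ (-‿inverseʳ 1#) (+-identityˡ (- 1#)) (+-mono-≤ (- 1#) 1≤0)
    -1*-1≈1 : - 1# * - 1# ≈ 1#
    -1*-1≈1 = trans (-1*x≈-x (- 1#)) (⁻¹-involutive 1#)

  1≰0 : ¬ (1# ≤ 0#)
  1≰0 1≤0 = 1≉0 (≤-antisym 1≤0 0≤1)

  nonneg-inverse : ∀ {x} → 0# ≤ x → ¬ (x ≈ 0#) → Σ Carrier λ y → 0# ≤ y × x * y ≈ 1#
  nonneg-inverse {x} 0≤x x≉0 with inverse x x≉0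
  ... | y , xy≈1 with ≤-total 0# y
  ...   | inj₁ 0≤y = y , 0≤y , xy≈1
  ...   | inj₂ y≤0 = ⊥-elim (1≰0 (≤-resp-≈ xy≈1 (zeroʳ x) (*-monoˡ-≤-nonneg 0≤x y≤0)))

  fromℕ-nonneg : ∀ n → 0# ≤ fromℕ n
  fromℕ-nonneg zero    = ≤-refl
  fromℕ-nonneg (suc n) = ≤-respˡ-≈ (+-identityˡ 0#) (+-mono₂-≤ 0≤1 (fromℕ-nonneg n))

  fromℕ-cong : ∀ {m n} → m ≡.≡ n → fromℕ m ≈ fromℕ n
  fromℕ-cong m≡n = reflexive (≡.cong fromℕ m≡n)

  fromℕ-+ : ∀ m n → fromℕ (m ℕ.+ n) ≈ fromℕ m + fromℕ n
  fromℕ-+ zero    n = sym (+-identityˡ _)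
  fromℕ-+ (suc m) n = trans (+-congˡ (fromℕ-+ m n)) (sym (+-assoc _ _ _))

  fromℕ-* : ∀ m n → fromℕ (m ℕ.* n) ≈ fromℕ m * fromℕ n
  fromℕ-* zero    n = sym (zeroˡ _)
  fromℕ-* (suc m) n = begin-equality
    fromℕ (n ℕ.+ m ℕ.* n)         ≈⟨ fromℕ-+ n (m ℕ.* n) ⟩
    fromℕ n + fromℕ (m ℕ.* n)     ≈⟨ +-cong (sym (*-identityˡ _)) (fromℕ-* m n) ⟩
    1# * fromℕ n + fromℕ m * fromℕ n ≈⟨ distribʳ (fromℕ n) 1# (fromℕ m) ⟨
    fromℕ (suc m) * fromℕ n       ∎
    where open ≤-Reasoning

  fromℕ-mono-≤ : ∀ {m n} → m ℕ.≤ n → fromℕ m ≤ fromℕ n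
  fromℕ-mono-≤ {m} {n} m≤n =
    ≤-resp-≈ (+-identityʳ _) m+[n-m]≈n (+-monoʳ-≤ (fromℕ m) (fromℕ-nonneg (n ℕ.∸ m)))
    where
    m+[n-m]≈n : fromℕ m + fromℕ (n ℕ.∸ m) ≈ fromℕ n
    m+[n-m]≈n = trans (sym (fromℕ-+ m (n ℕ.∸ m))) (fromℕ-cong (ℕ.m+[n∸m]≡n m≤n))

  fromℕ≉0 : ∀ n .{{_ : NonZero n}} → ¬ (fromℕ n ≈ 0#)
  fromℕ≉0 (suc n) 1+n≈0 =
    1≰0 (≤-respʳ-≈ 1+n≈0 (≤-respˡ-≈ (+-identityʳ 1#) (+-monoʳ-≤ 1# (fromℕ-nonneg n))))

  module _ (n : ℕ) .{{_ : NonZero n}} where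

    private
      fromℕ-inverse : Σ Carrier λ y → 0# ≤ y × fromℕ n * y ≈ 1#
      fromℕ-inverse = nonneg-inverse (fromℕ-nonneg n) (fromℕ≉0 n)

    1/ : Carrier
    1/ = proj₁ fromℕ-inverse

    1/-nonneg : 0# ≤ 1/
    1/-nonneg = proj₁ (proj₂ fromℕ-inverse)

    fromℕ*1/≈1 : fromℕ n * 1/ ≈ 1#
    fromℕ*1/≈1 = proj₂ (proj₂ fromℕ-inverse)

    fromℕ*[1/*x]≈x : ∀ x → fromℕ n * (1/ * x) ≈ x
    fromℕ*[1/*x]≈x x = trans (sym (*-assoc _ _ x)) (trans (*-congʳ fromℕ*1/≈1) (*-identityˡ x))

    1/*[fromℕ*x]≈x : ∀ x → 1/ * (fromℕ n * x) ≈ x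
    1/*[fromℕ*x]≈x x =
      trans (sym (*-assoc _ _ x)) (trans (*-congʳ (trans (*-comm _ _) fromℕ*1/≈1)) (*-identityˡ x))

    fromℕ*-cancelˡ-≤ : ∀ {x y} → fromℕ n * x ≤ fromℕ n * y → x ≤ y
    fromℕ*-cancelˡ-≤ nx≤ny =
      ≤-resp-≈ (1/*[fromℕ*x]≈x _) (1/*[fromℕ*x]≈x _) (*-monoˡ-≤-nonneg 1/-nonneg nx≤ny)

module ResidueClassProperties where

  open import Data.Nat using (_≤_)
  open import Data.Integer using (ℤ; -[1+_]; _*_; _+_; _-_; -_)
  open import Relation.Binary.PropositionalEquality
  open ≡-Reasoning

  record Residue (m l : ℕ) (z : ℤ) : Set where
    constructor residue
    field
      quotient : ℤ
      division : z ≡ + m * quotient + + l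

  pos-+-* : ∀ a b c → + (a ℕ.+ b ℕ.* c) ≡ + a + + b * + c
  pos-+-* a b c = trans (ℤ.pos-+ a (b ℕ.* c)) (cong (λ w → + a + w) (ℤ.pos-* b c))

  Residue-mod : ∀ {m l z} .{{_ : NonZero m}} → Residue m l z → Residue m (l % m) z
  Residue-mod {m} {l} (residue q refl) = residue (q + + (l / m)) (begin
    + m * q + + l                           ≡⟨ cong (λ n → + m * q + + n) (m≡m%n+[m/n]*n l m) ⟩
    + m * q + + (l % m ℕ.+ l / m ℕ.* m)     ≡⟨ cong (λ w → + m * q + w) (pos-+-* (l % m) (l / m) m) ⟩
    + m * q + (+ (l % m) + + (l / m) * + m) ≡⟨ regroup (+ m) q (+ (l % m)) (+ (l / m)) ⟩
    + m * (q + + (l / m)) + + (l % m)       ∎)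
    where
    regroup : ∀ m q r d → m * q + (r + d * m) ≡ m * (q + d) + r
    regroup = solve-∀

  Residue-refine : ∀ {m l z} n .{{_ : NonZero n}} → Residue m l z →
                   ∃ λ j → j < n × Residue (m ℕ.* n) (l ℕ.+ m ℕ.* j) z
  Residue-refine {m} {l} n (residue q refl) = j , n%ℕd<d q n , residue Q (begin
    + m * q + + l                           ≡⟨ cong (λ w → + m * w + + l) (a≡a%ℕn+[a/ℕn]*n q n) ⟩
    + m * (+ j + Q * + n) + + l             ≡⟨ regroup (+ m) (+ j) Q (+ n) (+ l) ⟩
    + m * + n * Q + (+ l + + m * + j)       ≡⟨ cong₂ (λ a b → a * Q + b) (ℤ.pos-* m n) (pos-+-* l m j) ⟨
    + (m ℕ.* n) * Q + + (l ℕ.+ m ℕ.* j)     ∎)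
    where
    j = q %ℕ n
    Q = q /ℕ n
    regroup : ∀ m j Q n l → m * (j + Q * n) + l ≡ m * n * Q + (l + m * j)
    regroup = solve-∀

  Residue-scale : ∀ {m l z} k → Residue m l z → Residue (k ℕ.* m) (k ℕ.* l) (+ k * z)
  Residue-scale {m} {l} k (residue q refl) = residue q (begin
    + k * (+ m * q + + l)             ≡⟨ distribute (+ k) (+ m) q (+ l) ⟩
    + k * + m * q + + k * + l         ≡⟨ cong₂ (λ a b → a * q + b) (ℤ.pos-* k m) (ℤ.pos-* k l) ⟨
    + (k ℕ.* m) * q + + (k ℕ.* l)     ∎)
    where
    distribute : ∀ k m q l → k * (m * q + l) ≡ k * m * q + k * l
    distribute = solve-∀

  +k*t≡+l⇒t≡+[l/k] : ∀ {k l} t .{{_ : NonZero k}} → + k * t ≡ + l → t ≡ + (l / k)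
  +k*t≡+l⇒t≡+[l/k] {k} {l} (+ n) kn≡l = cong +_ (begin
    n                 ≡⟨ m*n/n≡m n k ⟨
    n ℕ.* k / k       ≡⟨ cong (_/ k) (trans (ℕ.*-comm n k) (ℤ.+-injective (trans (ℤ.pos-* k n) kn≡l))) ⟩
    l / k             ∎)
  +k*t≡+l⇒t≡+[l/k] {suc k} -[1+ n ] ()

  Residue-unscale : ∀ {m l z} k .{{_ : NonZero k}} → Residue (m ℕ.* k) l (+ k * z) → Residue m (l / k) z
  Residue-unscale {m} {l} {z} k (residue q kz≡mkq+l) = residue q (begin
    z                      ≡⟨ split z (+ m * q) ⟩
    + m * q + t            ≡⟨ cong (λ w → + m * q + w) (+k*t≡+l⇒t≡+[l/k] t kt≡l) ⟩
    + m * q + + (l / k)    ∎)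
    where
    t = z - + m * q
    split : ∀ z a → z ≡ a + (z - a)
    split = solve-∀
    expand : ∀ k z m q → k * (z - m * q) ≡ k * z - m * k * q
    expand = solve-∀
    cancel : ∀ a l → a + l - a ≡ l
    cancel = solve-∀
    kt≡l : + k * t ≡ + l
    kt≡l = begin
      + k * (z - + m * q)                        ≡⟨ expand (+ k) z (+ m) q ⟩
      + k * z - + m * + k * q                    ≡⟨ cong (λ w → w - + m * + k * q) kz≡mkq+l ⟩
      + (m ℕ.* k) * q + + l - + m * + k * q      ≡⟨ cong (λ a → a * q + + l - + m * + k * q) (ℤ.pos-* m k) ⟩
      + m * + k * q + + l - + m * + k * q        ≡⟨ cancel (+ m * + k * q) (+ l) ⟩
      + l                                        ∎

  Residue-shift : ∀ {m l z} h → Residue m l z → Residue m (l ℕ.+ h) (z + + h)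
  Residue-shift {m} {l} h (residue q refl) = residue q (begin
    + m * q + + l + + h         ≡⟨ ℤ.+-assoc (+ m * q) (+ l) (+ h) ⟩
    + m * q + (+ l + + h)       ≡⟨ cong (λ w → + m * q + w) (ℤ.pos-+ l h) ⟨
    + m * q + + (l ℕ.+ h)       ∎)

  -- Subtracting h is adding (m − 1)·h modulo m, which keeps the residue a natural number.
  Residue-unshift : ∀ {m l z} .{{_ : NonZero m}} h → Residue m l (z + + h) → Residue m (l ℕ.+ ℕ.pred m ℕ.* h) z
  Residue-unshift {suc m} {l} {z} h (residue q z+h≡[1+m]q+l) = residue (q - + h) (begin
    z                                      ≡⟨ unshift z (+ h) ⟩
    z + + h - + h                          ≡⟨ cong (_- + h) z+h≡[1+m]q+l ⟩
    (+ 1 + + m) * q + + l - + h            ≡⟨ regroup (+ m) q (+ l) (+ h) ⟩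
    (+ 1 + + m) * (q - + h) + (+ l + + m * + h) ≡⟨ cong (λ w → + suc m * (q - + h) + w) (pos-+-* l m h) ⟨
    + suc m * (q - + h) + + (l ℕ.+ m ℕ.* h) ∎)
    where
    unshift : ∀ z h → z ≡ z + h - h
    unshift = solve-∀
    regroup : ∀ m q l h → (+ 1 + m) * q + l - h ≡ (+ 1 + m) * (q - h) + (l + m * h)
    regroup = solve-∀

  Residue⇒ℕ-division : ∀ {m l x} → l < m → Residue m l (+ x) → ∃ λ q → x ≡ m ℕ.* q ℕ.+ l
  Residue⇒ℕ-division {m} {l} {x} l<m (residue (+ q) x≡mq+l) = q , ℤ.+-injective (begin
    + x                        ≡⟨ x≡mq+l ⟩
    + m * + q + + l            ≡⟨ cong (_+ + l) (ℤ.pos-* m q) ⟨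
    + (m ℕ.* q) + + l          ≡⟨ ℤ.pos-+ (m ℕ.* q) l ⟨
    + (m ℕ.* q ℕ.+ l)          ∎)
  Residue⇒ℕ-division {m} {l} {x} l<m (residue -[1+ q ] x≡m[-1-q]+l) =
    ⊥-elim (ℕ.<⇒≱ l<m m≤l)
    where
    cancel : ∀ m s l → m * - s + l + m * s ≡ l
    cancel = solve-∀
    x+m[1+q]≡l : x ℕ.+ m ℕ.* suc q ≡ l
    x+m[1+q]≡l = ℤ.+-injective (begin
      + (x ℕ.+ m ℕ.* suc q)                  ≡⟨ pos-+-* x m (suc q) ⟩
      + x + + m * + suc q                    ≡⟨ cong (_+ + m * + suc q) x≡m[-1-q]+l ⟩
      + m * -[1+ q ] + + l + + m * + suc q   ≡⟨ cancel (+ m) (+ suc q) (+ l) ⟩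
      + l                                    ∎)
    m≤l : m ≤ l
    m≤l = ℕ.≤-trans (ℕ.m≤m*n m (suc q)) (ℕ.≤-trans (ℕ.m≤n+m _ x) (ℕ.≤-reflexive x+m[1+q]≡l))

  Residue-unique : ∀ {m l i} → i < m → l < m → Residue m l (+ i) → i ≡ l
  Residue-unique {suc m} {l} {i} i<m l<m r with q , i≡[1+m]q+l ← Residue⇒ℕ-division l<m r = begin
    i                            ≡⟨ m<n⇒m%n≡m i<m ⟨
    i % suc m                    ≡⟨ cong (_% suc m) (trans i≡[1+m]q+l (ℕ.+-comm (suc m ℕ.* q) l)) ⟩
    (l ℕ.+ suc m ℕ.* q) % suc m  ≡⟨ cong (λ n → (l ℕ.+ n) % suc m) (ℕ.*-comm (suc m) q) ⟩
    (l ℕ.+ q ℕ.* suc m) % suc m  ≡⟨ [m+kn]%n≡m%n l q (suc m) ⟩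
    l % suc m                    ≡⟨ m<n⇒m%n≡m l<m ⟩
    l                            ∎

  Residues : ℕ → List ℕ → Pred ℤ 0ℓ
  Residues m L z = Any (λ l → Residue m l z) L

  complete-residues⇒≤length : ∀ {m} L → (∀ i → i < m → Residues m L (+ i)) → m ≤ length L
  complete-residues⇒≤length {zero} L _ = ℕ.z≤n
  complete-residues⇒≤length {suc m} L covers = Fin.injective⇒≤ class-index-injective
    where
    class-of : (i : Fin (suc m)) → Residues (suc m) L (+ toℕ i)
    class-of i = covers (toℕ i) (Fin.toℕ<n i)
    residue-of : ∀ i → toℕ i ≡ lookup L (index (class-of i)) % suc m
    residue-of i = Residue-unique (Fin.toℕ<n i) (m%n<n (lookup L (index (class-of i))) (suc m))
                                  (Residue-mod (lookup-index (class-of i)))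
    class-index-injective : ∀ {i j} → index (class-of i) ≡ index (class-of j) → i ≡ j
    class-index-injective {i} {j} same = Fin.toℕ-injective
      (trans (residue-of i) (trans (cong (λ a → lookup L a % suc m) same) (sym (residue-of j))))

  Residues-map : ∀ {m m′ L z z′} (f : ℕ → ℕ) → (∀ {l} → Residue m l z → Residue m′ (f l) z′) →
                 Residues m L z → Residues m′ (map f L) z′
  Residues-map f g = map⁺ ∘ Any.map g

  refine : ℕ → ℕ → List ℕ → List ℕ
  refine m n = concatMap (λ l → applyUpTo (λ j → l ℕ.+ m ℕ.* j) n)

  length-refine : ∀ m n L → length (refine m n L) ≡ length L ℕ.* n
  length-refine m n []      = refl
  length-refine m n (l ∷ L) =
    trans (length-++ (applyUpTo _ n)) (cong₂ ℕ._+_ (length-applyUpTo _ n) (length-refine m n L))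

  Residues-refine : ∀ {m L z} n .{{_ : NonZero n}} → Residues m L z → Residues (m ℕ.* n) (refine m n L) z
  Residues-refine {m} n = concatMap⁺ _ ∘ Any.map λ {l} r →
    let j , j<n , r′ = Residue-refine {m} {l} n r in applyUpTo⁺ (λ j → l ℕ.+ m ℕ.* j) r′ j<n

  toℤ : (H : Host) → ⟦ H ⟧ → ℤ
  toℤ Hℕ x = + x
  toℤ Hℤ x = x

  toℤ-lin : ∀ H k x h → toℤ H (lin H k x h) ≡ + k * toℤ H x + + h
  toℤ-lin Hℕ k x h = trans (ℤ.pos-+ (k ℕ.* x) h) (cong (_+ + h) (ℤ.pos-* k x))
  toℤ-lin Hℤ k x h = refl

  toℤ-scale : ∀ H k x → toℤ H (lin H k x 0) ≡ + k * toℤ H x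
  toℤ-scale H k x = trans (toℤ-lin H k x 0) (ℤ.+-identityʳ _)

  toℤ-shift : ∀ H x h → toℤ H (lin H 1 x h) ≡ toℤ H x + + h
  toℤ-shift H x h = trans (toℤ-lin H 1 x h) (cong (_+ + h) (ℤ.*-identityˡ (toℤ H x)))

  embed : (H : Host) → ℕ → ⟦ H ⟧
  embed Hℕ i = i
  embed Hℤ i = + i

  toℤ-embed : ∀ H i → toℤ H (embed H i) ≡ + i
  toℤ-embed Hℕ i = refl
  toℤ-embed Hℤ i = refl

  ResidueClass : (H : Host) → ℕ → ℕ → Pred ⟦ H ⟧ 0ℓ
  ResidueClass H m l x = Residue m l (toℤ H x)

  ResidueClasses : (H : Host) → ℕ → List ℕ → Pred ⟦ H ⟧ 0ℓ
  ResidueClasses H m L x = Residues m L (toℤ H x)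

  lin∈ResidueClass : ∀ H m y l → ResidueClass H m l (lin H m y l)
  lin∈ResidueClass H m y l = residue (toℤ H y) (toℤ-lin H m y l)

  -- The residue must be reduced: in ℕ, 1 lies in the class of 3 modulo 2 but is not 2y + 3.
  ResidueClass⇒lin : ∀ H {m l x} → l < m → ResidueClass H m l x → ∃ λ y → x ≡ lin H m y l
  ResidueClass⇒lin Hℕ l<m r = Residue⇒ℕ-division l<m r
  ResidueClass⇒lin Hℤ l<m (residue q x≡mq+l) = q , x≡mq+l

  lin-1-lin : ∀ H k y h → lin H 1 (lin H k y 0) h ≡ lin H k y h
  lin-1-lin Hℕ k y h = cong (ℕ._+ h) (trans (ℕ.*-identityˡ _) (ℕ.+-identityʳ _))
  lin-1-lin Hℤ k y h = cong (_+ + h) (trans (ℤ.*-identityˡ _) (ℤ.+-identityʳ (+ k * y)))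

open ResidueClassProperties

module UpperBuckDensity (ℝ : RealField) (H : Host) where
  open RealField ℝ
  open OrderedFieldProperties ℝ
  open CommutativeSemigroupProperties *-commutativeSemigroup using (xy∙z≈y∙xz; xy∙z≈xz∙y; x∙yz≈y∙xz)
  open ≤-Reasoning

  record ResidueCover (X : Pred ⟦ H ⟧ 0ℓ) (c : Carrier) : Set where
    field
      modulus       : ℕ
      {{modulus≢0}} : NonZero modulus
      residues      : List ℕ
      density       : fromℕ modulus * c ≈ fromℕ (length residues)
      covers        : X ⊆ ResidueClasses H modulus residues

  open ResidueCover

  ResidueCover-nonneg : ∀ {X c} → ResidueCover X c → 0# ≤ c
  ResidueCover-nonneg C = fromℕ*-cancelˡ-≤ (modulus C)
    (≤-resp-≈ (sym (zeroʳ _)) (sym (density C)) (fromℕ-nonneg (length (residues C))))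

  ResidueCover-trivial : ∀ X → ResidueCover X 1#
  ResidueCover-trivial X = record
    { modulus  = 1
    ; residues = 0 ∷ []
    ; density  = *-identityʳ _
    ; covers   = λ {x} _ → here (residue (toℤ H x) (≡.sym (≡.trans (ℤ.+-identityʳ _) (ℤ.*-identityˡ _))))
    }

  ResidueCover-⊆ : ∀ {X Y c} → X ⊆ Y → ResidueCover Y c → ResidueCover X c
  ResidueCover-⊆ X⊆Y C = record
    { modulus = modulus C ; residues = residues C ; density = density C ; covers = covers C ∘ X⊆Y }

  ResidueCover-∪ : ∀ {X Y c d} → ResidueCover X c → ResidueCover Y d → ResidueCover (X ∪ Y) (c + d)
  ResidueCover-∪ {X} {Y} {c} {d} CX CY = record
    { modulus   = m ℕ.* n
    ; modulus≢0 = ℕ.m*n≢0 m n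
    ; residues  = refine m n L ++ refine n m M
    ; density   = density′
    ; covers    = covers′
    }
    where
    m = modulus CX
    n = modulus CY
    L = residues CX
    M = residues CY
    covers′ : X ∪ Y ⊆ ResidueClasses H (m ℕ.* n) (refine m n L ++ refine n m M)
    covers′ (inj₁ x∈X) = ++⁺ˡ (Residues-refine {m} n (covers CX x∈X))
    covers′ {x} (inj₂ x∈Y) = ++⁺ʳ (refine m n L)
      (≡.subst (λ k → Residues k (refine n m M) (toℤ H x)) (ℕ.*-comm n m) (Residues-refine {n} m (covers CY x∈Y)))
    length-residues : length (refine m n L ++ refine n m M) ≡.≡ length L ℕ.* n ℕ.+ length M ℕ.* m
    length-residues = ≡.trans (length-++ (refine m n L)) (≡.cong₂ ℕ._+_ (length-refine m n L) (length-refine n m M))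
    density′ : fromℕ (m ℕ.* n) * (c + d) ≈ fromℕ (length (refine m n L ++ refine n m M))
    density′ = begin-equality
      fromℕ (m ℕ.* n) * (c + d)                            ≈⟨ *-congʳ (fromℕ-* m n) ⟩
      fromℕ m * fromℕ n * (c + d)                          ≈⟨ distribˡ _ c d ⟩
      fromℕ m * fromℕ n * c + fromℕ m * fromℕ n * d        ≈⟨ +-cong (xy∙z≈xz∙y _ _ c) (*-congʳ (*-comm _ _)) ⟩
      fromℕ m * c * fromℕ n + fromℕ n * fromℕ m * d        ≈⟨ +-congˡ (xy∙z≈xz∙y _ _ d) ⟩
      fromℕ m * c * fromℕ n + fromℕ n * d * fromℕ m        ≈⟨ +-cong (*-congʳ (density CX)) (*-congʳ (density CY)) ⟩
      fromℕ (length L) * fromℕ n + fromℕ (length M) * fromℕ m ≈⟨ +-cong (fromℕ-* (length L) n) (fromℕ-* (length M) m) ⟨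
      fromℕ (length L ℕ.* n) + fromℕ (length M ℕ.* m)      ≈⟨ fromℕ-+ (length L ℕ.* n) (length M ℕ.* m) ⟨
      fromℕ (length L ℕ.* n ℕ.+ length M ℕ.* m)            ≈⟨ fromℕ-cong length-residues ⟨
      fromℕ (length (refine m n L ++ refine n m M))        ∎

  ResidueCover-scale : ∀ {X c} k .{{_ : NonZero k}} → ResidueCover X c → ResidueCover (k · X) (1/ k * c)
  ResidueCover-scale {X} {c} k C = record
    { modulus   = k ℕ.* m
    ; modulus≢0 = ℕ.m*n≢0 k m
    ; residues  = map (k ℕ.*_) (residues C)
    ; density   = begin-equality
        fromℕ (k ℕ.* m) * (1/ k * c)        ≈⟨ *-congʳ (fromℕ-* k m) ⟩
        fromℕ k * fromℕ m * (1/ k * c)      ≈⟨ xy∙z≈y∙xz _ _ _ ⟩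
        fromℕ m * (fromℕ k * (1/ k * c))    ≈⟨ *-congˡ (fromℕ*[1/*x]≈x k c) ⟩
        fromℕ m * c                         ≈⟨ density C ⟩
        fromℕ (length (residues C))         ≈⟨ fromℕ-cong (length-map (k ℕ.*_) (residues C)) ⟨
        fromℕ (length (map (k ℕ.*_) (residues C))) ∎
    ; covers    = λ where
        (x , x∈X , ≡.refl) → ≡.subst (Residues (k ℕ.* m) _) (≡.sym (toℤ-scale H k x))
                               (Residues-map (k ℕ.*_) (Residue-scale k) (covers C x∈X))
    }
    where
    m = modulus C

  ResidueCover-unscale : ∀ {X c} k .{{_ : NonZero k}} → ResidueCover (k · X) c → ResidueCover X (fromℕ k * c)
  ResidueCover-unscale {X} {c} k C = record
    { modulus   = m
    ; residues  = map (_/ k) (refine m k L)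
    ; density   = begin-equality
        fromℕ m * (fromℕ k * c)             ≈⟨ x∙yz≈y∙xz _ _ _ ⟩
        fromℕ k * (fromℕ m * c)             ≈⟨ *-congˡ (density C) ⟩
        fromℕ k * fromℕ (length L)          ≈⟨ *-comm _ _ ⟩
        fromℕ (length L) * fromℕ k          ≈⟨ fromℕ-* (length L) k ⟨
        fromℕ (length L ℕ.* k)              ≈⟨ fromℕ-cong (≡.trans (length-map (_/ k) (refine m k L)) (length-refine m k L)) ⟨
        fromℕ (length (map (_/ k) (refine m k L))) ∎
    ; covers    = λ {x} x∈X → Residues-map (_/ k) (Residue-unscale k)
        (Residues-refine {m} k (≡.subst (Residues m L) (toℤ-scale H k x) (covers C (x , x∈X , ≡.refl))))
    }
    where
    m = modulus C
    L = residues C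

  ResidueCover-shift : ∀ {X c} h → ResidueCover X c → ResidueCover (X +ₛ h) c
  ResidueCover-shift {X} {c} h C = record
    { modulus  = modulus C
    ; residues = map (ℕ._+ h) (residues C)
    ; density  = trans (density C) (fromℕ-cong (≡.sym (length-map (ℕ._+ h) (residues C))))
    ; covers   = λ where
        (x , x∈X , ≡.refl) → ≡.subst (Residues (modulus C) _) (≡.sym (toℤ-shift H x h))
                               (Residues-map (ℕ._+ h) (Residue-shift h) (covers C x∈X))
    }

  ResidueCover-unshift : ∀ {X c} h → ResidueCover (X +ₛ h) c → ResidueCover X c
  ResidueCover-unshift {X} {c} h C = record
    { modulus  = modulus C
    ; residues = map (λ l → l ℕ.+ ℕ.pred (modulus C) ℕ.* h) (residues C)
    ; density  = trans (density C) (fromℕ-cong (≡.sym (length-map _ (residues C))))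
    ; covers   = λ {x} x∈X → Residues-map _ (Residue-unshift h)
        (≡.subst (Residues (modulus C) (residues C)) (toℤ-shift H x h) (covers C (x , x∈X , ≡.refl)))
    }

  ResidueCover-U⇒1≤ : ∀ {c} → ResidueCover U c → 1# ≤ c
  ResidueCover-U⇒1≤ {c} C = fromℕ*-cancelˡ-≤ (modulus C) (begin
    fromℕ (modulus C) * 1#          ≈⟨ *-identityʳ _ ⟩
    fromℕ (modulus C)               ≤⟨ fromℕ-mono-≤ (complete-residues⇒≤length (residues C) covers-residues) ⟩
    fromℕ (length (residues C))     ≈⟨ density C ⟨
    fromℕ (modulus C) * c           ∎)
    where
    covers-residues : ∀ i → i ℕ.< modulus C → Residues (modulus C) (residues C) (+ i)
    covers-residues i _ = ≡.subst (Residues (modulus C) (residues C)) (toℤ-embed H i) (covers C _)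

  LowerBound : Pred ⟦ H ⟧ 0ℓ → Pred Carrier 0ℓ
  LowerBound X b = ∀ {c} → ResidueCover X c → b ≤ c

  private
    infimum : ∀ X → Σ Carrier λ β → (∀ b → LowerBound X b → b ≤ β) ×
                                    (∀ u → (∀ b → LowerBound X b → b ≤ u) → β ≤ u)
    infimum X = sup (λ b → LowerBound X b) (0# , ResidueCover-nonneg)
                    (1# , λ b lb → lb (ResidueCover-trivial X))

  buck : Pred ⟦ H ⟧ 0ℓ → Carrier
  buck X = proj₁ (infimum X)

  buck-≤ : ∀ {X c} → ResidueCover X c → buck X ≤ c
  buck-≤ {X} {c} C = proj₂ (proj₂ (infimum X)) c (λ b lb → lb C)

  ≤-buck : ∀ {X b} → LowerBound X b → b ≤ buck X
  ≤-buck {X} {b} lb = proj₁ (proj₂ (infimum X)) b lb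

  buck-nonneg : ∀ X → 0# ≤ buck X
  buck-nonneg X = ≤-buck ResidueCover-nonneg

  buck-mono : ∀ {X Y} → X ⊆ Y → buck X ≤ buck Y
  buck-mono X⊆Y = ≤-buck (buck-≤ ∘ ResidueCover-⊆ X⊆Y)

  buck-cong : ∀ {X Y} → X ≐ Y → buck X ≈ buck Y
  buck-cong (X⊆Y , Y⊆X) = ≤-antisym (buck-mono X⊆Y) (buck-mono Y⊆X)

  buck-≤1 : ∀ X → buck X ≤ 1#
  buck-≤1 X = buck-≤ (ResidueCover-trivial X)

  buck-U : buck U ≈ 1#
  buck-U = ≤-antisym (buck-≤1 U) (≤-buck ResidueCover-U⇒1≤)

  buck-subadditive : ∀ X Y → buck (X ∪ Y) ≤ buck X + buck Y
  buck-subadditive X Y = ≤-buck-+ λ CX → ≤-respʳ-≈ (+-comm _ _) (≤-buck-+ λ CY →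
    ≤-respʳ-≈ (+-comm _ _) (buck-≤ (ResidueCover-∪ CX CY)))
    where
    ≤-buck-+ : ∀ {Z b d} → (∀ {c} → ResidueCover Z c → b ≤ c + d) → b ≤ buck Z + d
    ≤-buck-+ b≤c+d = x-z≤y⇒x≤y+z (≤-buck (x≤y+z⇒x-z≤y ∘ b≤c+d))

  buck-scale : ∀ X k .{{_ : NonZero k}} → fromℕ k * buck (k · X) ≈ buck X
  buck-scale X k = ≤-antisym k*buck[k·X]≤buck[X] buck[X]≤k*buck[k·X]
    where
    k*buck[k·X]≤buck[X] : fromℕ k * buck (k · X) ≤ buck X
    k*buck[k·X]≤buck[X] = ≤-buck λ {c} C → begin
      fromℕ k * buck (k · X)      ≤⟨ *-monoˡ-≤-nonneg (fromℕ-nonneg k) (buck-≤ (ResidueCover-scale k C)) ⟩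
      fromℕ k * (1/ k * c)        ≈⟨ fromℕ*[1/*x]≈x k c ⟩
      c                           ∎
    buck[X]/k≤buck[k·X] : 1/ k * buck X ≤ buck (k · X)
    buck[X]/k≤buck[k·X] = ≤-buck λ {c} C → fromℕ*-cancelˡ-≤ k (begin
      fromℕ k * (1/ k * buck X)   ≈⟨ fromℕ*[1/*x]≈x k (buck X) ⟩
      buck X                      ≤⟨ buck-≤ (ResidueCover-unscale k C) ⟩
      fromℕ k * c                 ∎)
    buck[X]≤k*buck[k·X] : buck X ≤ fromℕ k * buck (k · X)
    buck[X]≤k*buck[k·X] = begin
      buck X                      ≈⟨ fromℕ*[1/*x]≈x k (buck X) ⟨
      fromℕ k * (1/ k * buck X)   ≤⟨ *-monoˡ-≤-nonneg (fromℕ-nonneg k) buck[X]/k≤buck[k·X] ⟩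
      fromℕ k * buck (k · X)      ∎

  buck-shift : ∀ X h → buck (X +ₛ h) ≈ buck X
  buck-shift X h =
    ≤-antisym (≤-buck (buck-≤ ∘ ResidueCover-shift h)) (≤-buck (buck-≤ ∘ ResidueCover-unshift h))

  buck-isUpperQuasiDensity : IsUpperQuasiDensity ℝ H buck
  buck-isUpperQuasiDensity = record
    { cong   = buck-cong
    ; ≤1     = buck-≤1
    ; full   = buck-U
    ; subadd = buck-subadditive
    ; scale  = buck-scale
    ; shift  = buck-shift
    }

module UpperQuasiDensityProperties {ℝ : RealField} {H : Host} {μ : Pred ⟦ H ⟧ 0ℓ → RealField.Carrier ℝ}
                                   (μ-isUQD : IsUpperQuasiDensity ℝ H μ) where
  open RealField ℝ
  open OrderedFieldProperties ℝ
  open IsUpperQuasiDensity μ-isUQD renaming (cong to μ-cong)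
  open UpperBuckDensity ℝ H
  open ≤-Reasoning

  μ-∅ : μ ∅ ≈ 0#
  μ-∅ = begin-equality
    μ ∅                  ≈⟨ x+y-y≈x (μ ∅) (μ ∅) ⟨
    μ ∅ + μ ∅ - μ ∅      ≈⟨ +-congʳ μ∅+μ∅≈μ∅ ⟩
    μ ∅ - μ ∅            ≈⟨ -‿inverseʳ (μ ∅) ⟩
    0#                   ∎
    where
    μ∅+μ∅≈μ∅ : μ ∅ + μ ∅ ≈ μ ∅
    μ∅+μ∅≈μ∅ = begin-equality
      μ ∅ + μ ∅                          ≈⟨ +-cong 1*μ∅≈μ∅ 1*μ∅≈μ∅ ⟨
      fromℕ 1 * μ ∅ + fromℕ 1 * μ ∅      ≈⟨ distribʳ (μ ∅) (fromℕ 1) (fromℕ 1) ⟨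
      (fromℕ 1 + fromℕ 1) * μ ∅          ≈⟨ *-congʳ (fromℕ-+ 1 1) ⟨
      fromℕ 2 * μ ∅                      ≈⟨ *-congˡ (μ-cong ((λ ()) , λ ())) ⟩
      fromℕ 2 * μ (2 · ∅)                ≈⟨ scale ∅ 2 ⟩
      μ ∅                                ∎
      where
      1*μ∅≈μ∅ : fromℕ 1 * μ ∅ ≈ μ ∅
      1*μ∅≈μ∅ = trans (*-congʳ (+-identityʳ 1#)) (*-identityˡ (μ ∅))

  μ-nonneg : ∀ X → 0# ≤ μ X
  μ-nonneg X = ≤-respˡ-≈ (-‿inverseʳ (μ X)) (x≤y+z⇒x-z≤y (≤-respˡ-≈ (μ-cong X∪X≐X) (subadd X X)))
    where
    X∪X≐X : X ∪ X ≐ X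
    X∪X≐X = (λ { (inj₁ x∈X) → x∈X ; (inj₂ x∈X) → x∈X }) , inj₁

  μ-ResidueClass : ∀ X {m l} .{{_ : NonZero m}} → l < m → fromℕ m * μ (X ∩ ResidueClass H m l) ≤ 1#
  μ-ResidueClass X {m} {l} l<m = begin
    fromℕ m * μ (X ∩ ResidueClass H m l)  ≈⟨ *-congˡ (trans (μ-cong X∩class≐shifted) (shift (m · Xₗ) l)) ⟩
    fromℕ m * μ (m · Xₗ)                  ≈⟨ scale Xₗ m ⟩
    μ Xₗ                                  ≤⟨ ≤1 Xₗ ⟩
    1#                                    ∎
    where
    Xₗ : Pred ⟦ H ⟧ 0ℓ
    Xₗ y = X (lin H m y l)
    X∩class≐shifted : X ∩ ResidueClass H m l ≐ (m · Xₗ) +ₛ l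
    X∩class≐shifted = into , out
      where
      into : X ∩ ResidueClass H m l ⊆ (m · Xₗ) +ₛ l
      into (x∈X , x∈class) with y , ≡.refl ← ResidueClass⇒lin H l<m x∈class =
        lin H m y 0 , (y , x∈X , ≡.refl) , ≡.sym (lin-1-lin H m y l)
      out : (m · Xₗ) +ₛ l ⊆ X ∩ ResidueClass H m l
      out (_ , (y , y∈Xₗ , ≡.refl) , ≡.refl) rewrite lin-1-lin H m y l = y∈Xₗ , lin∈ResidueClass H m y l

  μ-ResidueClasses : ∀ X {m} .{{_ : NonZero m}} {L} → All (_< m) L →
                     fromℕ m * μ (X ∩ ResidueClasses H m L) ≤ fromℕ (length L)
  μ-ResidueClasses X {m} [] = ≤-reflexive (trans (*-congˡ (trans (μ-cong ((λ ()) , λ ())) μ-∅)) (zeroʳ _))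
  μ-ResidueClasses X {m} {l ∷ L} (l<m ∷ L<m) = begin
    fromℕ m * μ (X ∩ ResidueClasses H m (l ∷ L))  ≈⟨ *-congˡ (μ-cong split) ⟩
    fromℕ m * μ (A ∪ B)                           ≤⟨ *-monoˡ-≤-nonneg (fromℕ-nonneg m) (subadd A B) ⟩
    fromℕ m * (μ A + μ B)                         ≈⟨ distribˡ _ _ _ ⟩
    fromℕ m * μ A + fromℕ m * μ B                 ≤⟨ +-mono₂-≤ (μ-ResidueClass X l<m) (μ-ResidueClasses X L<m) ⟩
    1# + fromℕ (length L)                         ∎
    where
    A B : Pred ⟦ H ⟧ 0ℓ
    A = X ∩ ResidueClass H m l
    B = X ∩ ResidueClasses H m L
    split : X ∩ ResidueClasses H m (l ∷ L) ≐ A ∪ B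
    split = (λ { (x∈X , here r) → inj₁ (x∈X , r) ; (x∈X , there rs) → inj₂ (x∈X , rs) })
          , (λ { (inj₁ (x∈X , r)) → x∈X , here r ; (inj₂ (x∈X , rs)) → x∈X , there rs })

  μ≤buck : ∀ X → μ X ≤ buck X
  μ≤buck X = ≤-buck μX≤
    where
    μX≤ : LowerBound X (μ X)
    μX≤ {c} C = fromℕ*-cancelˡ-≤ m (begin
      fromℕ m * μ X                           ≈⟨ *-congˡ (μ-cong X≐X∩classes) ⟩
      fromℕ m * μ (X ∩ ResidueClasses H m R)  ≤⟨ μ-ResidueClasses X R<m ⟩
      fromℕ (length R)                        ≈⟨ fromℕ-cong (length-map _ residues) ⟩
      fromℕ (length residues)                 ≈⟨ density ⟨
      fromℕ m * c                             ∎)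
      where
      open ResidueCover C renaming (modulus to m)
      R : List ℕ
      R = map (_% m) residues
      R<m : All (_< m) R
      R<m = All.map⁺ (All.universal (λ l → m%n<n l m) residues)
      X≐X∩classes : X ≐ X ∩ ResidueClasses H m R
      X≐X∩classes = (λ x∈X → x∈X , Residues-map _ Residue-mod (covers x∈X)) , proj₁

module SmallSets (ℝ : RealField) (H : Host) where
  open RealField ℝ
  open OrderedFieldProperties ℝ
  open UpperBuckDensity ℝ H
  open UpperQuasiDensityProperties using (μ-∅; μ-nonneg; μ≤buck)
  open ≤-Reasoning

  buck≈0⇒Small : ∀ {X} → buck X ≈ 0# → Small ℝ H X
  buck≈0⇒Small {X} buckX≈0 μ μ-isUQD =
    ≤-antisym (≤-respʳ-≈ buckX≈0 (μ≤buck μ-isUQD X)) (μ-nonneg μ-isUQD X)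

  Small-∅ : Small ℝ H ∅
  Small-∅ μ μ-isUQD = μ-∅ μ-isUQD

  Small-⊆ : ∀ {X Y} → X ⊆ Y → Small ℝ H Y → Small ℝ H X
  Small-⊆ X⊆Y Y-small = buck≈0⇒Small
    (≤-antisym (≤-respʳ-≈ (Y-small buck buck-isUpperQuasiDensity) (buck-mono X⊆Y)) (buck-nonneg _))

  Small-∪ : ∀ {X Y} → Small ℝ H X → Small ℝ H Y → Small ℝ H (X ∪ Y)
  Small-∪ {X} {Y} X-small Y-small μ μ-isUQD = ≤-antisym (begin
    μ (X ∪ Y)    ≤⟨ IsUpperQuasiDensity.subadd μ-isUQD X Y ⟩
    μ X + μ Y    ≈⟨ +-cong (X-small μ μ-isUQD) (Y-small μ μ-isUQD) ⟩
    0# + 0#      ≈⟨ +-identityʳ 0# ⟩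
    0#           ∎) (μ-nonneg μ-isUQD (X ∪ Y))

  Small⇒¬U⊆ : ∀ {X} → Small ℝ H X → ¬ (U ⊆ X)
  Small⇒¬U⊆ {X} X-small U⊆X = 1≉0 (begin-equality
    1#           ≈⟨ buck-U ⟨
    buck U       ≈⟨ buck-cong (U⊆X , λ _ → tt) ⟩
    buck X       ≈⟨ X-small buck buck-isUpperQuasiDensity ⟩
    0#           ∎)

corollary2p5 : (ℝ : RealField) (H : Host) → IsIdeal (Small ℝ H)
corollary2p5 ℝ H = record
  { proper   = Small⇒¬U⊆
  ; empty    = Small-∅
  ; downward = Small-⊆
  ; union    = Small-∪
  }
  where open SmallSets ℝ H
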